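{- Let $\mathbb T$ be the theory of bounded distributive lattices or of $\sigma$-frames, and assume (SQCF). Then $\mathbb I$ is simplicial, i.e. right orthogonal to the inclusion $\Delta^2\cup\Delta_2\hookrightarrow\mathbb I^2$.
   Context: We work in intensional type theory with function extensionality. $\mathbb I$ is a model of $\mathbb T$; an $\mathbb I$-algebra is a $\mathbb T$-model with a homomorphism from $\mathbb I$. $\operatorname{Spec}A:=\mathbb I\text{ - }\mathbf{Alg}(A,\mathbb I)$; $\mathcal O X:=\mathbb I^X$; $A$ is quasi-coherent if $\iota_A:A\to\mathcal O\operatorname{Spec}A$, $a\mapsto(x\mapsto x(a))$, is an isomorphism. (SQCF): every finitely presented $\mathbb I$-algebra $\mathbb I[n]/(a=b)$ ($n,m:\mathbb N$, $a,b:m\to\mathbb I[n]$) is quasi-coherent. $\Delta^2:=\{(i,j):\mathbb I^2\mid i\ge j\}$, $\Delta_2:=\{(i,j):\mathbb I^2\mid i\le j\}$, and $\Delta^2\cup\Delta_2$ is their union as subtypes of $\mathbb I^2$ (the pushout over the diagonal $\mathbb I$). $X$ is right orthogonal to $f:A\to B$ if $X^B\to X^A$ is an equivalence. -}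

module Defs where

open import Level using (Level; _⊔_; Lift) renaming (suc to lsuc)
open import Data.Nat using (ℕ)
open import Data.Fin using (Fin)
open import Data.Unit using (tt) renaming (⊤ to Unit)
open import Data.Empty using () renaming (⊥ to Empty)
open import Data.Product using (Σ; _×_; _,_; proj₁; proj₂)
open import Relation.Binary.PropositionalEquality
  using (_≡_; refl; sym; trans; cong; cong₂)

isProp : ∀ {a} → Set a → Set a
isProp A = (x y : A) → x ≡ y

isSet : ∀ {a} → Set a → Set a
isSet A = (x y : A) → isProp (x ≡ y)

-- f is an equivalence (stated via a quasi-inverse, which is logically
-- equivalent to being an equivalence)
IsEquiv : ∀ {a b} {A : Set a} {B : Set b} → (A → B) → Set (a ⊔ b)
IsEquiv {A = A} {B} f =
  Σ (B → A) λ g → ((x : A) → g (f x) ≡ x) × ((y : B) → f (g y) ≡ y)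

-- propositional truncation (impredicative encoding, eliminating into
-- propositions of level ℓ)
∥_∥ : ∀ {a} (ℓ : Level) → Set a → Set (a ⊔ lsuc ℓ)
∥_∥ ℓ A = (P : Set ℓ) → isProp P → (A → P) → P

data Theory : Set where
  dlat   : Theory
  σframe : Theory

HasJoins : Theory → Set
HasJoins dlat   = Empty
HasJoins σframe = Unit

record DLatStr {ℓ} (A : Set ℓ) : Set ℓ where
  infixr 7 _∧_
  infixr 6 _∨_
  field
    ⊥ ⊤ : A
    _∧_ _∨_ : A → A → A
    ∧-assoc : ∀ x y z → (x ∧ y) ∧ z ≡ x ∧ (y ∧ z)
    ∨-assoc : ∀ x y z → (x ∨ y) ∨ z ≡ x ∨ (y ∨ z)
    ∧-comm  : ∀ x y → x ∧ y ≡ y ∧ x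
    ∨-comm  : ∀ x y → x ∨ y ≡ y ∨ x
    ∧-absorbs-∨ : ∀ x y → x ∧ (x ∨ y) ≡ x
    ∨-absorbs-∧ : ∀ x y → x ∨ (x ∧ y) ≡ x
    ∨-identity : ∀ x → x ∨ ⊥ ≡ x
    ∧-identity : ∀ x → x ∧ ⊤ ≡ x
    ∧-distrib-∨ : ∀ x y z → x ∧ (y ∨ z) ≡ (x ∧ y) ∨ (x ∧ z)

  _≤_ : A → A → Set ℓ
  x ≤ y = x ∧ y ≡ x

  ∧-idem : ∀ x → x ∧ x ≡ x
  ∧-idem x = trans (cong (x ∧_) (sym (∨-absorbs-∧ x x))) (∧-absorbs-∨ x (x ∧ x))

  ≤-refl : ∀ x → x ≤ x
  ≤-refl = ∧-idem

record σStr {ℓ} {A : Set ℓ} (L : DLatStr A) : Set ℓ where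
  open DLatStr L
  field
    ⋁ : (ℕ → A) → A
    ⋁-ub    : ∀ x n → x n ≤ ⋁ x
    ⋁-least : ∀ x y → (∀ n → x n ≤ y) → ⋁ x ≤ y
    ⋁-distrib : ∀ x y → x ∧ ⋁ y ≡ ⋁ (λ n → x ∧ y n)

Extra : ∀ {ℓ} (T : Theory) {A : Set ℓ} → DLatStr A → Set ℓ
Extra dlat   L = Lift _ Unit
Extra σframe L = σStr L

joinOf : ∀ {ℓ} (T : Theory) {A : Set ℓ} {L : DLatStr A} →
         Extra T L → HasJoins T → (ℕ → A) → A
joinOf σframe e tt = σStr.⋁ e

-- a model of 𝕋 (models of algebraic theories are sets)
record Model (T : Theory) (ℓ : Level) : Set (lsuc ℓ) where
  field
    Carrier : Set ℓ
    carrier-isSet : isSet Carrier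
    lat : DLatStr Carrier
    extra : Extra T lat
  open DLatStr lat public

  ⋁ᵀ : HasJoins T → (ℕ → Carrier) → Carrier
  ⋁ᵀ = joinOf T extra

-- Finitely presented 𝕀-algebras 𝕀[n]/(a = b), presented as the term
-- algebra modulo the least congruence generated by the axioms of 𝕋,
-- the operation tables of 𝕀 and the relations a k = b k.

module _ {T : Theory} {ℓ : Level} (𝕀 : Model T ℓ) where
  open Model 𝕀

  data Term (n : ℕ) : Set ℓ where
    var   : Fin n → Term n
    const : Carrier → Term n
    ⊥' ⊤' : Term n
    _∧'_ _∨'_ : Term n → Term n → Term n
    ⋁' : HasJoins T → (ℕ → Term n) → Term n

  data Cong {n m : ℕ} (a b : Fin m → Term n) : Term n → Term n → Set ℓ where
    c-refl  : ∀ x → Cong a b x x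
    c-sym   : ∀ {x y} → Cong a b x y → Cong a b y x
    c-trans : ∀ {x y z} → Cong a b x y → Cong a b y z → Cong a b x z
    c-∧ : ∀ {x x' y y'} → Cong a b x x' → Cong a b y y' → Cong a b (x ∧' y) (x' ∧' y')
    c-∨ : ∀ {x x' y y'} → Cong a b x x' → Cong a b y y' → Cong a b (x ∨' y) (x' ∨' y')
    c-⋁ : ∀ s {x y : ℕ → Term n} → (∀ k → Cong a b (x k) (y k)) → Cong a b (⋁' s x) (⋁' s y)
    ax-∧-assoc : ∀ x y z → Cong a b ((x ∧' y) ∧' z) (x ∧' (y ∧' z))
    ax-∨-assoc : ∀ x y z → Cong a b ((x ∨' y) ∨' z) (x ∨' (y ∨' z))
    ax-∧-comm  : ∀ x y → Cong a b (x ∧' y) (y ∧' x)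
    ax-∨-comm  : ∀ x y → Cong a b (x ∨' y) (y ∨' x)
    ax-∧-absorbs-∨ : ∀ x y → Cong a b (x ∧' (x ∨' y)) x
    ax-∨-absorbs-∧ : ∀ x y → Cong a b (x ∨' (x ∧' y)) x
    ax-∨-identity : ∀ x → Cong a b (x ∨' ⊥') x
    ax-∧-identity : ∀ x → Cong a b (x ∧' ⊤') x
    ax-∧-distrib-∨ : ∀ x y z → Cong a b (x ∧' (y ∨' z)) ((x ∧' y) ∨' (x ∧' z))
    ax-⋁-ub : ∀ s x k → Cong a b (x k ∧' ⋁' s x) (x k)
    ax-⋁-least : ∀ s x y → (∀ k → Cong a b (x k ∧' y) (x k)) → Cong a b (⋁' s x ∧' y) (⋁' s x)
    ax-⋁-distrib : ∀ s x y → Cong a b (x ∧' ⋁' s y) (⋁' s (λ k → x ∧' y k))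
    k-⊥ : Cong a b (const ⊥) ⊥'
    k-⊤ : Cong a b (const ⊤) ⊤'
    k-∧ : ∀ i j → Cong a b (const (i ∧ j)) (const i ∧' const j)
    k-∨ : ∀ i j → Cong a b (const (i ∨ j)) (const i ∨' const j)
    k-⋁ : ∀ s (i : ℕ → Carrier) → Cong a b (const (⋁ᵀ s i)) (⋁' s (λ k → const (i k)))
    rel : ∀ k → Cong a b (a k) (b k)

  record Spec {n m : ℕ} (a b : Fin m → Term n) : Set ℓ where
    field
      hom : Term n → Carrier
      hom-resp : ∀ {x y} → Cong a b x y → hom x ≡ hom y
      hom-⊥ : hom ⊥' ≡ ⊥
      hom-⊤ : hom ⊤' ≡ ⊤
      hom-∧ : ∀ x y → hom (x ∧' y) ≡ hom x ∧ hom y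
      hom-∨ : ∀ x y → hom (x ∨' y) ≡ hom x ∨ hom y
      hom-⋁ : ∀ s x → hom (⋁' s x) ≡ ⋁ᵀ s (λ k → hom (x k))
      hom-const : ∀ i → hom (const i) ≡ i

  ι : ∀ {n m} (a b : Fin m → Term n) → Term n → (Spec a b → Carrier)
  ι a b t x = Spec.hom x t

  -- quasi-coherence of 𝕀[n]/(a=b): ι is bijective on the quotient
  -- (injective modulo the congruence, and surjective)
  QuasiCoherent : ∀ {n m} (a b : Fin m → Term n) → Set (lsuc ℓ)
  QuasiCoherent a b =
      (∀ s t → ι a b s ≡ ι a b t → Cong a b s t)
    × (∀ (f : Spec a b → Carrier) → ∥ ℓ ∥ (Σ (Term _) λ t → ι a b t ≡ f))

SQCF : ∀ {T ℓ} → Model T ℓ → Set (lsuc ℓ)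
SQCF 𝕀 = ∀ (n m : ℕ) (a b : Fin m → Term 𝕀 n) → QuasiCoherent 𝕀 a b

module _ {T : Theory} {ℓ : Level} (𝕀 : Model T ℓ) where
  open Model 𝕀

  Δ² : Set ℓ
  Δ² = Σ (Carrier × Carrier) λ p → proj₂ p ≤ proj₁ p

  Δ₂ : Set ℓ
  Δ₂ = Σ (Carrier × Carrier) λ p → proj₁ p ≤ proj₂ p

  diag² : Carrier → Δ²
  diag² i = (i , i) , ≤-refl i

  diag₂ : Carrier → Δ₂
  diag₂ i = (i , i) , ≤-refl i

  -- maps Δ² ∪ Δ₂ → 𝕀, i.e. maps out of the pushout of Δ² ← 𝕀 → Δ₂
  -- (by its universal property: cocones)
  record MapsFromUnion : Set ℓ where
    constructor cocone
    field
      on-Δ² : Δ² → Carrier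
      on-Δ₂ : Δ₂ → Carrier
      glue  : ∀ i → on-Δ² (diag² i) ≡ on-Δ₂ (diag₂ i)

  restrict : (Carrier × Carrier → Carrier) → MapsFromUnion
  restrict φ = cocone (λ p → φ (proj₁ p)) (λ p → φ (proj₁ p)) (λ i → refl)

  Simplicial : Set ℓ
  Simplicial = IsEquiv restrict

-- By (SQCF), every function on the spectrum of a finitely presented 𝕀-algebra, in
-- particular every function on 𝕀², Δ² or Δ₂, is merely a polynomial with constants.
-- Polynomials preserve every reflexive relation on 𝕀 closed under the operations of
-- 𝕋; this makes them monotone, and it gives, for a binary polynomial φ, the bounds
-- φ(i,j) ∧ i ≤ φ(i, i∧j),  φ(i,j) ∧ j ≤ φ(i∧j, j)  and  φ(i,j) ≤ φ(⊥,⊥) ∨ i ∨ j,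
-- whence by distributivity the splitting  φ(i,j) = φ(i, i∧j) ∨ φ(i∧j, j).
-- Hence a map (f, g) out of Δ² ∪ Δ₂ has the unique extension
-- (i,j) ↦ f(i, i∧j) ∨ g(i∧j, j) to 𝕀², which restricts back to (f, g) because f and g
-- are monotone and agree on the diagonal.
module Submission where

open import Defs
open import Level using (Level)
open import Axiom.Extensionality.Propositional using (Extensionality)
open import Algebra.Lattice.Bundles using (Lattice)
import Algebra.Lattice.Properties.Lattice as LatticeProperties
open import Relation.Binary.Lattice using (DistributiveLattice)
import Relation.Binary.Lattice.Properties.DistributiveLattice as DistributiveLatticeProperties
import Relation.Binary.Lattice.Properties.JoinSemilattice as JoinSemilatticeProperties
import Relation.Binary.Lattice.Properties.MeetSemilattice as MeetSemilatticeProperties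
import Relation.Binary.Reasoning.PartialOrder as ≤-Reasoning
open import Data.Nat using (ℕ)
open import Data.Fin using (Fin; zero; suc)
open import Data.Unit using (tt)
open import Data.Product using (Σ; _×_; _,_; proj₁; proj₂)
open import Relation.Binary.PropositionalEquality
  using (_≡_; refl; sym; trans; cong; cong₂; cong-app; subst₂; isEquivalence;
         module ≡-Reasoning)

∥∥-map : ∀ {a b ℓ} {A : Set a} {B : Set b} → (A → B) → ∥ ℓ ∥ A → ∥ ℓ ∥ B
∥∥-map f ∣a∣ P P-prop g = ∣a∣ P P-prop (λ a → g (f a))

module DLatStrProperties {a} {A : Set a} (L : DLatStr A) where
  open DLatStr L hiding (_≤_; ≤-refl)

  lattice : Lattice a a
  lattice = record
    { Carrier = A ; _≈_ = _≡_ ; _∨_ = _∨_ ; _∧_ = _∧_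
    ; isLattice = record
      { isEquivalence = isEquivalence
      ; ∨-comm = ∨-comm ; ∨-assoc = ∨-assoc ; ∨-cong = cong₂ _∨_
      ; ∧-comm = ∧-comm ; ∧-assoc = ∧-assoc ; ∧-cong = cong₂ _∧_
      ; absorptive = ∨-absorbs-∧ , ∧-absorbs-∨
      }
    }

  distributiveLattice : DistributiveLattice a a a
  distributiveLattice = record
    { isDistributiveLattice = record
      { isLattice = LatticeProperties.∨-∧-isOrderTheoreticLattice lattice
      ; ∧-distribˡ-∨ = ∧-distrib-∨
      }
    }

  -- The library's order is x ≡ x ∧ y, the symmetric form of DLatStr._≤_.
  open DistributiveLattice distributiveLattice public using (_≤_)

  ⊥-minimum : ∀ x → ⊥ ≤ x
  ⊥-minimum x = sym (begin
    ⊥ ∧ x        ≡⟨ cong (⊥ ∧_) (trans (sym (∨-identity x)) (∨-comm x ⊥)) ⟩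
    ⊥ ∧ (⊥ ∨ x)  ≡⟨ ∧-absorbs-∨ ⊥ x ⟩
    ⊥            ∎)
    where open ≡-Reasoning

⋁ᵀ-ub : ∀ {T ℓ} (𝕀 : Model T ℓ) → let open Model 𝕀 in
        ∀ s (x : ℕ → Carrier) n → x n ≤ ⋁ᵀ s x
⋁ᵀ-ub {σframe} 𝕀 tt = σStr.⋁-ub (Model.extra 𝕀)

⋁ᵀ-least : ∀ {T ℓ} (𝕀 : Model T ℓ) → let open Model 𝕀 in
           ∀ s (x : ℕ → Carrier) y → (∀ n → x n ≤ y) → ⋁ᵀ s x ≤ y
⋁ᵀ-least {σframe} 𝕀 tt = σStr.⋁-least (Model.extra 𝕀)

⋁ᵀ-distrib : ∀ {T ℓ} (𝕀 : Model T ℓ) → let open Model 𝕀 in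
             ∀ s x (y : ℕ → Carrier) → x ∧ ⋁ᵀ s y ≡ ⋁ᵀ s (λ n → x ∧ y n)
⋁ᵀ-distrib {σframe} 𝕀 tt = σStr.⋁-distrib (Model.extra 𝕀)

module Simpliciality (funext : ∀ {a b} → Extensionality a b)
                     {T : Theory} {ℓ : Level} (𝕀 : Model T ℓ) where
  open Model 𝕀 using (Carrier; carrier-isSet; lat; ⊥; ⊤; _∧_; _∨_; ⋁ᵀ; ∧-comm; ∨-comm)
  open DLatStrProperties lat using (distributiveLattice; _≤_; ⊥-minimum)
  open DistributiveLattice distributiveLattice
    using (antisym; reflexive; x≤x∨y; y≤x∨y; ∨-least; x∧y≤x; x∧y≤y; ∧-greatest;
           ∧-distribˡ-∨; joinSemilattice; meetSemilattice; poset)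
    renaming (refl to ≤-refl; trans to ≤-trans)
  open DistributiveLatticeProperties distributiveLattice using (∧-distribʳ-∨; ∨-distribʳ-∧)
  open JoinSemilatticeProperties joinSemilattice using (∨-monotonic; x≤y⇒x∨y≈y)
  open MeetSemilatticeProperties meetSemilattice using (∧-monotonic)

  ≤-isProp : ∀ {x y} → isProp (x ≤ y)
  ≤-isProp = carrier-isSet _ _

  x≤⋁ : ∀ s (x : ℕ → Carrier) n → x n ≤ ⋁ᵀ s x
  x≤⋁ s x n = sym (⋁ᵀ-ub 𝕀 s x n)

  ⋁-least : ∀ s (x : ℕ → Carrier) {y} → (∀ n → x n ≤ y) → ⋁ᵀ s x ≤ y
  ⋁-least s x x≤y = sym (⋁ᵀ-least 𝕀 s x _ (λ n → sym (x≤y n)))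

  ⋁-distribʳ : ∀ s (x : ℕ → Carrier) y → ⋁ᵀ s x ∧ y ≡ ⋁ᵀ s (λ n → x n ∧ y)
  ⋁-distribʳ s x y = begin
    ⋁ᵀ s x ∧ y                ≡⟨ ∧-comm _ y ⟩
    y ∧ ⋁ᵀ s x                ≡⟨ ⋁ᵀ-distrib 𝕀 s y x ⟩
    ⋁ᵀ s (λ n → y ∧ x n)      ≡⟨ cong (⋁ᵀ s) (funext λ n → ∧-comm y (x n)) ⟩
    ⋁ᵀ s (λ n → x n ∧ y)      ∎
    where open ≡-Reasoning

  record IsReflexiveCompatible (R : Carrier → Carrier → Set ℓ) : Set ℓ where
    field
      reflexive-R : ∀ u → R u u
      ∧-compatible : ∀ {u u′ v v′} → R u u′ → R v v′ → R (u ∧ v) (u′ ∧ v′)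
      ∨-compatible : ∀ {u u′ v v′} → R u u′ → R v v′ → R (u ∨ v) (u′ ∨ v′)
      ⋁-compatible : ∀ s {u u′ : ℕ → Carrier} → (∀ n → R (u n) (u′ n)) →
                     R (⋁ᵀ s u) (⋁ᵀ s u′)

  ≤-isReflexiveCompatible : IsReflexiveCompatible _≤_
  ≤-isReflexiveCompatible = record
    { reflexive-R = λ _ → ≤-refl
    ; ∧-compatible = ∧-monotonic
    ; ∨-compatible = ∨-monotonic
    ; ⋁-compatible = λ s {u} {u′} u≤u′ → ⋁-least s u (λ n → ≤-trans (u≤u′ n) (x≤⋁ s u′ n))
    }

  ∧-below-isReflexiveCompatible : ∀ x → IsReflexiveCompatible (λ u u′ → u ∧ x ≤ u′)
  ∧-below-isReflexiveCompatible x = record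
    { reflexive-R = λ u → x∧y≤x u x
    ; ∧-compatible = λ {u} {_} {v} u∧x≤u′ v∧x≤v′ → ∧-greatest
        (≤-trans (∧-monotonic (x∧y≤x u v) ≤-refl) u∧x≤u′)
        (≤-trans (∧-monotonic (x∧y≤y u v) ≤-refl) v∧x≤v′)
    ; ∨-compatible = λ {u} {_} {v} u∧x≤u′ v∧x≤v′ →
        ≤-trans (reflexive (∧-distribʳ-∨ x u v)) (∨-monotonic u∧x≤u′ v∧x≤v′)
    ; ⋁-compatible = λ s {u} {u′} u∧x≤u′ →
        ≤-trans (reflexive (⋁-distribʳ s u x))
                (⋁-least s _ (λ n → ≤-trans (u∧x≤u′ n) (x≤⋁ s u′ n)))
    }

  below-∨-isReflexiveCompatible : ∀ w → IsReflexiveCompatible (λ u u′ → u ≤ u′ ∨ w)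
  below-∨-isReflexiveCompatible w = record
    { reflexive-R = λ u → x≤x∨y u w
    ; ∧-compatible = λ {_} {u′} {_} {v′} u≤u′∨w v≤v′∨w →
        ≤-trans (∧-monotonic u≤u′∨w v≤v′∨w) (reflexive (sym (∨-distribʳ-∧ w u′ v′)))
    ; ∨-compatible = λ {_} {u′} {_} {v′} u≤u′∨w v≤v′∨w → ∨-least
        (≤-trans u≤u′∨w (∨-monotonic (x≤x∨y u′ v′) ≤-refl))
        (≤-trans v≤v′∨w (∨-monotonic (y≤x∨y u′ v′) ≤-refl))
    ; ⋁-compatible = λ s {u} {u′} u≤u′∨w →
        ⋁-least s u (λ n → ≤-trans (u≤u′∨w n) (∨-monotonic (x≤⋁ s u′ n) ≤-refl))
    }

  eval : ∀ {n} → (Fin n → Carrier) → Term 𝕀 n → Carrier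
  eval e (var v)   = e v
  eval e (const c) = c
  eval e ⊥'        = ⊥
  eval e ⊤'        = ⊤
  eval e (t ∧' u)  = eval e t ∧ eval e u
  eval e (t ∨' u)  = eval e t ∨ eval e u
  eval e (⋁' s t)  = ⋁ᵀ s (λ k → eval e (t k))

  eval-preserves : ∀ {R} → IsReflexiveCompatible R →
                   ∀ {n} {e e′ : Fin n → Carrier} → (∀ v → R (e v) (e′ v)) →
                   ∀ t → R (eval e t) (eval e′ t)
  eval-preserves {R} R-compatible {e = e} {e′} eRe′ = go
    where
      open IsReflexiveCompatible R-compatible
      go : ∀ t → R (eval e t) (eval e′ t)
      go (var v)   = eRe′ v
      go (const c) = reflexive-R c
      go ⊥'        = reflexive-R ⊥
      go ⊤'        = reflexive-R ⊤
      go (t ∧' u)  = ∧-compatible (go t) (go u)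
      go (t ∨' u)  = ∨-compatible (go t) (go u)
      go (⋁' s t)  = ⋁-compatible s (λ k → go (t k))

  eval-monotone : ∀ {n} {e e′ : Fin n → Carrier} → (∀ v → e v ≤ e′ v) →
                  ∀ t → eval e t ≤ eval e′ t
  eval-monotone = eval-preserves ≤-isReflexiveCompatible

  pair : Carrier → Carrier → Fin 2 → Carrier
  pair i j zero       = i
  pair i j (suc zero) = j

  eval-split : ∀ i j t →
               eval (pair i j) t ≡ eval (pair i (i ∧ j)) t ∨ eval (pair (i ∧ j) j) t
  eval-split i j t = antisym P≤Pᵢ∨Pⱼ (∨-least Pᵢ≤P Pⱼ≤P)
    where
      P = eval (pair i j) t
      Pᵢ = eval (pair i (i ∧ j)) t
      Pⱼ = eval (pair (i ∧ j) j) t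
      P₀ = eval (pair ⊥ ⊥) t

      Pᵢ≤P : Pᵢ ≤ P
      Pᵢ≤P = eval-monotone (λ { zero → ≤-refl ; (suc zero) → x∧y≤y i j }) t

      Pⱼ≤P : Pⱼ ≤ P
      Pⱼ≤P = eval-monotone (λ { zero → x∧y≤x i j ; (suc zero) → ≤-refl }) t

      P₀≤Pᵢ : P₀ ≤ Pᵢ
      P₀≤Pᵢ = eval-monotone (λ { zero → ⊥-minimum i ; (suc zero) → ⊥-minimum (i ∧ j) }) t

      P∧i≤Pᵢ : P ∧ i ≤ Pᵢ
      P∧i≤Pᵢ = eval-preserves (∧-below-isReflexiveCompatible i)
        (λ { zero → x∧y≤x i i ; (suc zero) → reflexive (∧-comm j i) }) t

      P∧j≤Pⱼ : P ∧ j ≤ Pⱼ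
      P∧j≤Pⱼ = eval-preserves (∧-below-isReflexiveCompatible j)
        (λ { zero → ≤-refl ; (suc zero) → x∧y≤x j j }) t

      P≤P₀∨i∨j : P ≤ P₀ ∨ (i ∨ j)
      P≤P₀∨i∨j = eval-preserves (below-∨-isReflexiveCompatible (i ∨ j))
        (λ { zero       → ≤-trans (x≤x∨y i j) (y≤x∨y ⊥ (i ∨ j))
           ; (suc zero) → ≤-trans (y≤x∨y i j) (y≤x∨y ⊥ (i ∨ j)) }) t

      open ≤-Reasoning poset
      P≤Pᵢ∨Pⱼ : P ≤ Pᵢ ∨ Pⱼ
      P≤Pᵢ∨Pⱼ = begin
        P                               ≤⟨ ∧-greatest ≤-refl P≤P₀∨i∨j ⟩
        P ∧ (P₀ ∨ (i ∨ j))              ≈⟨ ∧-distribˡ-∨ P P₀ (i ∨ j) ⟩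
        P ∧ P₀ ∨ P ∧ (i ∨ j)            ≈⟨ cong (P ∧ P₀ ∨_) (∧-distribˡ-∨ P i j) ⟩
        P ∧ P₀ ∨ (P ∧ i ∨ P ∧ j)        ≤⟨ ∨-monotonic (x∧y≤y P P₀) (∨-monotonic P∧i≤Pᵢ P∧j≤Pⱼ) ⟩
        P₀ ∨ (Pᵢ ∨ Pⱼ)                  ≤⟨ ∨-least (≤-trans P₀≤Pᵢ (x≤x∨y Pᵢ Pⱼ)) ≤-refl ⟩
        Pᵢ ∨ Pⱼ                         ∎

  module _ {n m : ℕ} (a b : Fin m → Term 𝕀 n) where
    Solves : (Fin n → Carrier) → Set ℓ
    Solves e = ∀ k → eval e (a k) ≡ eval e (b k)

    Solves-isProp : ∀ {e} → isProp (Solves e)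
    Solves-isProp s s′ = funext λ k → carrier-isSet _ _ (s k) (s′ k)

    eval-respects-Cong : ∀ {e} → Solves e → ∀ {t u} → Cong 𝕀 a b t u → eval e t ≡ eval e u
    eval-respects-Cong s (c-refl t)              = refl
    eval-respects-Cong s (c-sym p)               = sym (eval-respects-Cong s p)
    eval-respects-Cong s (c-trans p q)           = trans (eval-respects-Cong s p) (eval-respects-Cong s q)
    eval-respects-Cong s (c-∧ p q)               = cong₂ _∧_ (eval-respects-Cong s p) (eval-respects-Cong s q)
    eval-respects-Cong s (c-∨ p q)               = cong₂ _∨_ (eval-respects-Cong s p) (eval-respects-Cong s q)
    eval-respects-Cong s (c-⋁ t p)               = cong (⋁ᵀ t) (funext λ k → eval-respects-Cong s (p k))
    eval-respects-Cong s (ax-∧-assoc x y z)      = Model.∧-assoc 𝕀 _ _ _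
    eval-respects-Cong s (ax-∨-assoc x y z)      = Model.∨-assoc 𝕀 _ _ _
    eval-respects-Cong s (ax-∧-comm x y)         = ∧-comm _ _
    eval-respects-Cong s (ax-∨-comm x y)         = ∨-comm _ _
    eval-respects-Cong s (ax-∧-absorbs-∨ x y)    = Model.∧-absorbs-∨ 𝕀 _ _
    eval-respects-Cong s (ax-∨-absorbs-∧ x y)    = Model.∨-absorbs-∧ 𝕀 _ _
    eval-respects-Cong s (ax-∨-identity x)       = Model.∨-identity 𝕀 _
    eval-respects-Cong s (ax-∧-identity x)       = Model.∧-identity 𝕀 _
    eval-respects-Cong s (ax-∧-distrib-∨ x y z)  = Model.∧-distrib-∨ 𝕀 _ _ _
    eval-respects-Cong s (ax-⋁-ub t x k)         = ⋁ᵀ-ub 𝕀 t _ k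
    eval-respects-Cong s (ax-⋁-least t x y p)    = ⋁ᵀ-least 𝕀 t _ _ (λ k → eval-respects-Cong s (p k))
    eval-respects-Cong s (ax-⋁-distrib t x y)    = ⋁ᵀ-distrib 𝕀 t _ _
    eval-respects-Cong s k-⊥                     = refl
    eval-respects-Cong s k-⊤                     = refl
    eval-respects-Cong s (k-∧ i j)               = refl
    eval-respects-Cong s (k-∨ i j)               = refl
    eval-respects-Cong s (k-⋁ t i)               = refl
    eval-respects-Cong s (rel k)                 = s k

    point : ∀ {e} → Solves e → Spec 𝕀 a b
    point {e} s = record
      { hom = eval e ; hom-resp = eval-respects-Cong s
      ; hom-⊥ = refl ; hom-⊤ = refl ; hom-∧ = λ _ _ → refl ; hom-∨ = λ _ _ → refl
      ; hom-⋁ = λ _ _ → refl ; hom-const = λ _ → refl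
      }

    coordinates : Spec 𝕀 a b → Fin n → Carrier
    coordinates σ v = Spec.hom σ (var v)

    hom≡eval-coordinates : ∀ σ t → Spec.hom σ t ≡ eval (coordinates σ) t
    hom≡eval-coordinates σ (var v)   = refl
    hom≡eval-coordinates σ (const c) = Spec.hom-const σ c
    hom≡eval-coordinates σ ⊥'        = Spec.hom-⊥ σ
    hom≡eval-coordinates σ ⊤'        = Spec.hom-⊤ σ
    hom≡eval-coordinates σ (t ∧' u)  =
      trans (Spec.hom-∧ σ t u) (cong₂ _∧_ (hom≡eval-coordinates σ t) (hom≡eval-coordinates σ u))
    hom≡eval-coordinates σ (t ∨' u)  =
      trans (Spec.hom-∨ σ t u) (cong₂ _∨_ (hom≡eval-coordinates σ t) (hom≡eval-coordinates σ u))
    hom≡eval-coordinates σ (⋁' s t)  =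
      trans (Spec.hom-⋁ σ s t) (cong (⋁ᵀ s) (funext λ k → hom≡eval-coordinates σ (t k)))

    coordinates-solve : ∀ σ → Solves (coordinates σ)
    coordinates-solve σ k = begin
      eval (coordinates σ) (a k)  ≡⟨ sym (hom≡eval-coordinates σ (a k)) ⟩
      Spec.hom σ (a k)            ≡⟨ Spec.hom-resp σ (rel k) ⟩
      Spec.hom σ (b k)            ≡⟨ hom≡eval-coordinates σ (b k) ⟩
      eval (coordinates σ) (b k)  ∎
      where open ≡-Reasoning

    polynomial-on-solutions : SQCF 𝕀 → (F : ∀ e → Solves e → Carrier) →
                              ∥ ℓ ∥ (Σ (Term 𝕀 n) λ t → ∀ e s → eval e t ≡ F e s)
    polynomial-on-solutions sqcf F =
      ∥∥-map (λ { (t , ιt≡F) → t , λ e s →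
                   trans (cong-app ιt≡F (point s)) (cong (F e) (Solves-isProp _ s)) })
             (proj₂ (sqcf n m a b) (λ σ → F (coordinates σ) (coordinates-solve σ)))

    monotone-on-solutions : SQCF 𝕀 → (F : ∀ e → Solves e → Carrier) →
                            ∀ {e e′} {s : Solves e} {s′ : Solves e′} →
                            (∀ v → e v ≤ e′ v) → F e s ≤ F e′ s′
    monotone-on-solutions sqcf F e≤e′ = polynomial-on-solutions sqcf F _ ≤-isProp
      λ { (t , t≡F) → subst₂ _≤_ (t≡F _ _) (t≡F _ _) (eval-monotone e≤e′ t) }

  no-relations : Fin 0 → Term 𝕀 2
  no-relations ()

  split : SQCF 𝕀 → (φ : Carrier × Carrier → Carrier) →
          ∀ i j → φ (i , j) ≡ φ (i , i ∧ j) ∨ φ (i ∧ j , j)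
  split sqcf φ i j =
    polynomial-on-solutions no-relations no-relations sqcf (λ e _ → φ (e zero , e (suc zero)))
      _ (carrier-isSet _ _) λ { (t , t≡φ) → begin
        φ (i , j)                                         ≡⟨ sym (t≡φ _ (λ ())) ⟩
        eval (pair i j) t                                 ≡⟨ eval-split i j t ⟩
        eval (pair i (i ∧ j)) t ∨ eval (pair (i ∧ j) j) t ≡⟨ cong₂ _∨_ (t≡φ _ (λ ())) (t≡φ _ (λ ())) ⟩
        φ (i , i ∧ j) ∨ φ (i ∧ j , j)                     ∎ }
    where open ≡-Reasoning

  Δ²-monotone : SQCF 𝕀 → (f : Δ² 𝕀 → Carrier) →
                ∀ {i j i′ j′ p p′} → i ≤ i′ → j ≤ j′ → f ((i , j) , p) ≤ f ((i′ , j′) , p′)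
  Δ²-monotone sqcf f {i} {j} {i′} {j′} {p} {p′} i≤i′ j≤j′ =
    monotone-on-solutions {m = 1} (λ _ → var (suc zero) ∧' var zero) (λ _ → var (suc zero)) sqcf
      (λ e s → f ((e zero , e (suc zero)) , s zero))
      {e = pair i j} {pair i′ j′} {λ _ → p} {λ _ → p′}
      (λ { zero → i≤i′ ; (suc zero) → j≤j′ })

  Δ₂-monotone : SQCF 𝕀 → (f : Δ₂ 𝕀 → Carrier) →
                ∀ {i j i′ j′ p p′} → i ≤ i′ → j ≤ j′ → f ((i , j) , p) ≤ f ((i′ , j′) , p′)
  Δ₂-monotone sqcf f {i} {j} {i′} {j′} {p} {p′} i≤i′ j≤j′ =
    monotone-on-solutions {m = 1} (λ _ → var zero ∧' var (suc zero)) (λ _ → var zero) sqcf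
      (λ e s → f ((e zero , e (suc zero)) , s zero))
      {e = pair i j} {pair i′ j′} {λ _ → p} {λ _ → p′}
      (λ { zero → i≤i′ ; (suc zero) → j≤j′ })

  equation-subtype-cong : ∀ {lhs rhs : Carrier × Carrier → Carrier}
                          (f : Σ (Carrier × Carrier) (λ x → lhs x ≡ rhs x) → Carrier) →
                          ∀ {x y px py} → x ≡ y → f (x , px) ≡ f (y , py)
  equation-subtype-cong f {px = px} {py} refl = cong (λ q → f (_ , q)) (carrier-isSet _ _ px py)

  extend : MapsFromUnion 𝕀 → Carrier × Carrier → Carrier
  extend (cocone f g _) (i , j) =
    f ((i , i ∧ j) , sym (x∧y≤x i j)) ∨ g ((i ∧ j , j) , sym (x∧y≤y i j))

  cocone-≡ : ∀ {f f′ g g′ glue glue′} → f ≡ f′ → g ≡ g′ →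
             cocone {𝕀 = 𝕀} f g glue ≡ cocone f′ g′ glue′
  cocone-≡ refl refl = cong (cocone _ _) (funext λ i → carrier-isSet _ _ _ _)

  extend-restrict : SQCF 𝕀 → ∀ φ → extend (restrict 𝕀 φ) ≡ φ
  extend-restrict sqcf φ = funext λ { (i , j) → sym (split sqcf φ i j) }

  restrict-extend : SQCF 𝕀 → ∀ c → restrict 𝕀 (extend c) ≡ c
  restrict-extend sqcf c@(cocone f g glue) = cocone-≡ (funext on-Δ²) (funext on-Δ₂)
    where
      open ≡-Reasoning

      on-Δ² : ∀ x → extend c (proj₁ x) ≡ f x
      on-Δ² x@((i , j) , j∧i≡j) = begin
        extend c (i , j)                 ≡⟨ cong₂ _∨_ (equation-subtype-cong f (cong (i ,_) i∧j≡j))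
                                                      (equation-subtype-cong g (cong (_, j) i∧j≡j)) ⟩
        f x ∨ g (diag₂ 𝕀 j)              ≡⟨ cong (f x ∨_) (sym (glue j)) ⟩
        f x ∨ f (diag² 𝕀 j)              ≡⟨ ∨-comm _ _ ⟩
        f (diag² 𝕀 j) ∨ f x              ≡⟨ x≤y⇒x∨y≈y (Δ²-monotone sqcf f (sym j∧i≡j) ≤-refl) ⟩
        f x                              ∎
        where i∧j≡j = trans (∧-comm i j) j∧i≡j

      on-Δ₂ : ∀ x → extend c (proj₁ x) ≡ g x
      on-Δ₂ x@((i , j) , i∧j≡i) = begin
        extend c (i , j)                 ≡⟨ cong₂ _∨_ (equation-subtype-cong f (cong (i ,_) i∧j≡i))
                                                      (equation-subtype-cong g (cong (_, j) i∧j≡i)) ⟩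
        f (diag² 𝕀 i) ∨ g x              ≡⟨ cong (_∨ g x) (glue i) ⟩
        g (diag₂ 𝕀 i) ∨ g x              ≡⟨ x≤y⇒x∨y≈y (Δ₂-monotone sqcf g ≤-refl (sym i∧j≡i)) ⟩
        g x                              ∎

proposition9p3 : (funext : ∀ {a b} → Extensionality a b)
                 (T : Theory) {ℓ : Level} (𝕀 : Model T ℓ) →
                 SQCF 𝕀 → Simplicial 𝕀
proposition9p3 funext T 𝕀 sqcf = extend , extend-restrict sqcf , restrict-extend sqcf
  where open Simpliciality funext 𝕀
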